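{- Let $G=(V,E)$ be a graph with $|V|=n$, and let $k,\ell$ be integers with $1\le k\le n$ and $\ell\ge 1$. Then $G\in\mathfrak{Gr}(n,k,\ell)$ if and only if $$n-\min\{|N[X]\,\triangle\,N[Y]| : X,Y\subseteq V,\ X\ne Y,\ |X|\le\ell,\ |Y|\le\ell\}\le k-1.$$
   Context: All graphs are finite, simple and undirected. For a graph $G=(V,E)$ and $x\in V$, $N[x]=\{x\}\cup\{y: xy\in E\}$; for $X\subseteq V$, $N[X]=\bigcup_{x\in X}N[x]$ (so $N[\emptyset]=\emptyset$). $A\triangle B=(A\setminus B)\cup(B\setminus A)$. A set $C\subseteq V$ is $(1,\le\ell)$-identifying if $N[X]\cap C\neq N[Y]\cap C$ for all distinct $X,Y\subseteq V$ with $|X|\le\ell$, $|Y|\le\ell$. For $n\ge k\ge1$ and $\ell\ge1$, $\mathfrak{Gr}(n,k,\ell)$ is the set of graphs on $n$ vertices in which every $k$-element subset of vertices is $(1,\le\ell)$-identifying. -}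

module Defs where

open import Data.Nat using (ℕ; _≤_; _∸_)
open import Data.Bool using (Bool; true; false; _∧_; _∨_; _xor_; not)
open import Data.Fin using (Fin)
open import Data.Fin.Subset using (Subset; _∈_; _∩_; ∣_∣)
open import Data.Vec using (tabulate; lookup; zipWith)
open import Data.Vec.Relation.Unary.Any using (Any)
open import Data.Product using (Σ; _×_; ∃)
open import Relation.Binary.PropositionalEquality using (_≡_; _≢_)
open import Relation.Nullary using (¬_)

record Graph (n : ℕ) : Set where
  field
    adj     : Fin n → Fin n → Bool
    symm    : ∀ x y → adj x y ≡ adj y x
    irrefl  : ∀ x → adj x x ≡ false

open Graph public

closedAdj : ∀ {n} → Graph n → Fin n → Fin n → Bool
closedAdj {n} G x y with Data.Fin._≟_ x y
... | Relation.Nullary.yes _ = true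
... | Relation.Nullary.no  _ = adj G x y
  where open import Data.Fin

-- N[X] = ⋃_{x ∈ X} N[x]  (so N[∅] = ∅), as a subset of Fin n.
anyFin : ∀ {n} → (Fin n → Bool) → Bool
anyFin {n} f = Data.Vec.foldr _ _∨_ false (tabulate f)
  where import Data.Vec

N[_]_ : ∀ {n} → Graph n → Subset n → Subset n
N[ G ] X = tabulate (λ y → anyFin (λ x → lookup X x ∧ closedAdj G x y))

_△_ : ∀ {n} → Subset n → Subset n → Subset n
A △ B = zipWith _xor_ A B

Identifying : ∀ {n} → Graph n → ℕ → Subset n → Set
Identifying G ℓ C =
  ∀ X Y → ∣ X ∣ ≤ ℓ → ∣ Y ∣ ≤ ℓ → X ≢ Y → (N[ G ] X) ∩ C ≢ (N[ G ] Y) ∩ C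

InGr : ∀ {n} → Graph n → ℕ → ℕ → Set
InGr {n} G k ℓ = ∀ (C : Subset n) → ∣ C ∣ ≡ k → Identifying G ℓ C

IsMinSymDiff : ∀ {n} → Graph n → ℕ → ℕ → Set
IsMinSymDiff {n} G ℓ m =
  (Σ (Subset n) λ X → Σ (Subset n) λ Y →
     ∣ X ∣ ≤ ℓ × ∣ Y ∣ ≤ ℓ × X ≢ Y × ∣ (N[ G ] X) △ (N[ G ] Y) ∣ ≡ m)
  × (∀ X Y → ∣ X ∣ ≤ ℓ → ∣ Y ∣ ≤ ℓ → X ≢ Y →
       m ≤ ∣ (N[ G ] X) △ (N[ G ] Y) ∣)

-- A set C fails to distinguish A and B (A ∩ C ≡ B ∩ C) exactly when C avoids
-- A △ B, and a k-element set avoiding a d-element subset of an n-set exists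
-- iff k + d ≤ n. Hence every k-set is (1,≤ℓ)-identifying iff
-- n < k + |N[X] △ N[Y]| for all admissible pairs X ≠ Y, i.e. iff n < k + m
-- for the minimum m, which is n ∸ m ≤ k ∸ 1.
module Submission where

open import Defs
open import Data.Nat using (ℕ; zero; suc; _+_; _∸_; _≤_; _<_; z≤n; s≤s; s≤s⁻¹)
open import Data.Nat.Properties
  using (+-suc; +-comm; +-monoʳ-≤; m≤n⇒m≤1+n; m≤n+o⇒m∸n≤o; <⇒≱; ≰⇒>; <-≤-trans)
open import Data.Bool using (true; false)
open import Data.Vec using (_∷_; [])
open import Data.Vec.Properties using (∷-injectiveʳ)
open import Data.Fin.Subset using (Subset; ⊥; _∩_; ∣_∣)
open import Data.Fin.Subset.Properties using (∣⊥∣≡0; ∩-zeroʳ)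
open import Data.Product using (Σ; _×_; _,_)
open import Function.Bundles using (_⇔_; mk⇔; Equivalence)
open import Function.Properties.Equivalence using () renaming (trans to ⇔-trans)
open import Relation.Binary.PropositionalEquality
  using (_≡_; _≢_; refl; sym; trans; cong; subst)

m∸n≤o⇒m≤n+o : ∀ m n {o} → m ∸ n ≤ o → m ≤ n + o
m∸n≤o⇒m≤n+o zero    n       _  = z≤n
m∸n≤o⇒m≤n+o (suc m) zero    le = le
m∸n≤o⇒m≤n+o (suc m) (suc n) le = s≤s (m∸n≤o⇒m≤n+o m n le)

m<1+o+n⇔m∸n≤o : ∀ m n o → m < suc o + n ⇔ m ∸ n ≤ o
m<1+o+n⇔m∸n≤o m n o = mk⇔
  (λ lt → m≤n+o⇒m∸n≤o m n (subst (m ≤_) (+-comm o n) (s≤s⁻¹ lt)))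
  (λ le → s≤s (subst (m ≤_) (+-comm n o) (m∸n≤o⇒m≤n+o m n le)))

∩≡∩⇒∣C∣+∣A△B∣≤n : ∀ {n} (A B C : Subset n) → A ∩ C ≡ B ∩ C →
                  ∣ C ∣ + ∣ A △ B ∣ ≤ n
∩≡∩⇒∣C∣+∣A△B∣≤n [] [] [] _ = z≤n
∩≡∩⇒∣C∣+∣A△B∣≤n (true ∷ A) (true ∷ B) (true ∷ C) eq =
  s≤s (∩≡∩⇒∣C∣+∣A△B∣≤n A B C (∷-injectiveʳ eq))
∩≡∩⇒∣C∣+∣A△B∣≤n (false ∷ A) (false ∷ B) (true ∷ C) eq =
  s≤s (∩≡∩⇒∣C∣+∣A△B∣≤n A B C (∷-injectiveʳ eq))
∩≡∩⇒∣C∣+∣A△B∣≤n (true ∷ A) (false ∷ B) (true ∷ C) ()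
∩≡∩⇒∣C∣+∣A△B∣≤n (false ∷ A) (true ∷ B) (true ∷ C) ()
∩≡∩⇒∣C∣+∣A△B∣≤n (true ∷ A) (true ∷ B) (false ∷ C) eq =
  m≤n⇒m≤1+n (∩≡∩⇒∣C∣+∣A△B∣≤n A B C (∷-injectiveʳ eq))
∩≡∩⇒∣C∣+∣A△B∣≤n (false ∷ A) (false ∷ B) (false ∷ C) eq =
  m≤n⇒m≤1+n (∩≡∩⇒∣C∣+∣A△B∣≤n A B C (∷-injectiveʳ eq))
∩≡∩⇒∣C∣+∣A△B∣≤n (true ∷ A) (false ∷ B) (false ∷ C) eq
  rewrite +-suc ∣ C ∣ ∣ A △ B ∣ = s≤s (∩≡∩⇒∣C∣+∣A△B∣≤n A B C (∷-injectiveʳ eq))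
∩≡∩⇒∣C∣+∣A△B∣≤n (false ∷ A) (true ∷ B) (false ∷ C) eq
  rewrite +-suc ∣ C ∣ ∣ A △ B ∣ = s≤s (∩≡∩⇒∣C∣+∣A△B∣≤n A B C (∷-injectiveʳ eq))

k+∣A△B∣≤n⇒∃[C]∣C∣≡k×∩≡∩ : ∀ {n} (A B : Subset n) k → k + ∣ A △ B ∣ ≤ n →
                           Σ (Subset n) λ C → ∣ C ∣ ≡ k × A ∩ C ≡ B ∩ C
k+∣A△B∣≤n⇒∃[C]∣C∣≡k×∩≡∩ {n} A B zero _ =
  ⊥ , ∣⊥∣≡0 n , trans (∩-zeroʳ A) (sym (∩-zeroʳ B))
k+∣A△B∣≤n⇒∃[C]∣C∣≡k×∩≡∩ (true ∷ A) (true ∷ B) (suc k) (s≤s le)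
  with C , ∣C∣≡k , eq ← k+∣A△B∣≤n⇒∃[C]∣C∣≡k×∩≡∩ A B k le =
  true ∷ C , cong suc ∣C∣≡k , cong (true ∷_) eq
k+∣A△B∣≤n⇒∃[C]∣C∣≡k×∩≡∩ (false ∷ A) (false ∷ B) (suc k) (s≤s le)
  with C , ∣C∣≡k , eq ← k+∣A△B∣≤n⇒∃[C]∣C∣≡k×∩≡∩ A B k le =
  true ∷ C , cong suc ∣C∣≡k , cong (false ∷_) eq
k+∣A△B∣≤n⇒∃[C]∣C∣≡k×∩≡∩ (true ∷ A) (false ∷ B) (suc k) le
  rewrite +-suc k ∣ A △ B ∣
  with C , ∣C∣≡k , eq ← k+∣A△B∣≤n⇒∃[C]∣C∣≡k×∩≡∩ A B (suc k) (s≤s⁻¹ le) =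
  false ∷ C , ∣C∣≡k , cong (false ∷_) eq
k+∣A△B∣≤n⇒∃[C]∣C∣≡k×∩≡∩ (false ∷ A) (true ∷ B) (suc k) le
  rewrite +-suc k ∣ A △ B ∣
  with C , ∣C∣≡k , eq ← k+∣A△B∣≤n⇒∃[C]∣C∣≡k×∩≡∩ A B (suc k) (s≤s⁻¹ le) =
  false ∷ C , ∣C∣≡k , cong (false ∷_) eq

∀[∣C∣≡k]∩≢∩⇔n<k+∣A△B∣ : ∀ {n} k (A B : Subset n) →
  (∀ C → ∣ C ∣ ≡ k → A ∩ C ≢ B ∩ C) ⇔ n < k + ∣ A △ B ∣
∀[∣C∣≡k]∩≢∩⇔n<k+∣A△B∣ {n} k A B = mk⇔ separates⇒< <⇒separates
  where
  separates⇒< : (∀ C → ∣ C ∣ ≡ k → A ∩ C ≢ B ∩ C) → n < k + ∣ A △ B ∣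
  separates⇒< separates = ≰⇒> λ le →
    let C , ∣C∣≡k , eq = k+∣A△B∣≤n⇒∃[C]∣C∣≡k×∩≡∩ A B k le
    in separates C ∣C∣≡k eq

  <⇒separates : n < k + ∣ A △ B ∣ → ∀ C → ∣ C ∣ ≡ k → A ∩ C ≢ B ∩ C
  <⇒separates lt C refl eq = <⇒≱ lt (∩≡∩⇒∣C∣+∣A△B∣≤n A B C eq)

LargeSymDiffs : ∀ {n} → Graph n → ℕ → ℕ → Set
LargeSymDiffs {n} G k ℓ =
  ∀ X Y → ∣ X ∣ ≤ ℓ → ∣ Y ∣ ≤ ℓ → X ≢ Y → n < k + ∣ (N[ G ] X) △ (N[ G ] Y) ∣

InGr⇔LargeSymDiffs : ∀ {n} (G : Graph n) k ℓ →
  InGr G k ℓ ⇔ LargeSymDiffs G k ℓ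
InGr⇔LargeSymDiffs {n} G k ℓ = mk⇔
  (λ inGr X Y ∣X∣≤ℓ ∣Y∣≤ℓ X≢Y → Equivalence.to (separation X Y)
     λ C ∣C∣≡k → inGr C ∣C∣≡k X Y ∣X∣≤ℓ ∣Y∣≤ℓ X≢Y)
  (λ large C ∣C∣≡k X Y ∣X∣≤ℓ ∣Y∣≤ℓ X≢Y → Equivalence.from (separation X Y)
     (large X Y ∣X∣≤ℓ ∣Y∣≤ℓ X≢Y) C ∣C∣≡k)
  where
  separation : ∀ X Y → (∀ C → ∣ C ∣ ≡ k → (N[ G ] X) ∩ C ≢ (N[ G ] Y) ∩ C) ⇔
                        n < k + ∣ (N[ G ] X) △ (N[ G ] Y) ∣
  separation X Y = ∀[∣C∣≡k]∩≢∩⇔n<k+∣A△B∣ k (N[ G ] X) (N[ G ] Y)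

IsMinSymDiff⇒LargeSymDiffs⇔n<k+m : ∀ {n} (G : Graph n) k ℓ m →
  IsMinSymDiff G ℓ m → LargeSymDiffs G k ℓ ⇔ n < k + m
IsMinSymDiff⇒LargeSymDiffs⇔n<k+m G k ℓ m
  ((X , Y , ∣X∣≤ℓ , ∣Y∣≤ℓ , X≢Y , ∣△∣≡m) , m≤∣△∣) = mk⇔
  (λ large → subst (λ d → _ < k + d) ∣△∣≡m (large X Y ∣X∣≤ℓ ∣Y∣≤ℓ X≢Y))
  (λ lt X′ Y′ ∣X′∣≤ℓ ∣Y′∣≤ℓ X′≢Y′ →
     <-≤-trans lt (+-monoʳ-≤ k (m≤∣△∣ X′ Y′ ∣X′∣≤ℓ ∣Y′∣≤ℓ X′≢Y′)))

theorem7 : (n k ℓ : ℕ) (G : Graph n) → 1 ≤ k → k ≤ n → 1 ≤ ℓ →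
    (m : ℕ) → IsMinSymDiff G ℓ m →
    (InGr G k ℓ ⇔ (n ∸ m ≤ k ∸ 1))
theorem7 n (suc k) ℓ G _ _ _ m isMin =
  ⇔-trans (InGr⇔LargeSymDiffs G (suc k) ℓ)
    (⇔-trans (IsMinSymDiff⇒LargeSymDiffs⇔n<k+m G (suc k) ℓ m isMin)
      (m<1+o+n⇔m∸n≤o n m k))
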